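{- Let $M \geq m \geq t \geq 1$ be integers. Then $s'_{3,t}(M) \geq (1-t/m)\, s'_{3,t}(m)$.
   Context: All graphs are finite and simple. For $t\ge1$, a $(3,t)'$-system is a pair $(H,\mathcal{F})$ where $H$ is a triangle-free graph and $\mathcal{F}$ is a family (without repeated elements) of subsets of $V(H)$, each of size exactly $t$, each of which is a maximal independent set of $H$. $s'_{3,t}(m)$ is the maximum of $|\mathcal{F}|$ over all $(3,t)'$-systems $(H,\mathcal{F})$ with $|V(H)|=m$. -}

module Defs where

open import Data.Nat using (ℕ; _≤_)
open import Data.Bool using (Bool; true; false)
open import Data.Fin using (Fin)
open import Data.Fin.Subset using (Subset; _∈_; _⊆_; ∣_∣)
open import Data.List using (List; length)
open import Data.List.Relation.Unary.All using (All)
open import Data.List.Relation.Unary.Unique.Propositional using (Unique)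
open import Data.Product using (Σ; ∃; _×_)
open import Relation.Binary.PropositionalEquality using (_≡_)
open import Relation.Nullary using (¬_)

record Graph (m : ℕ) : Set where
  field
    adj    : Fin m → Fin m → Bool
    sym    : ∀ i j → adj i j ≡ adj j i
    irrefl : ∀ i → adj i i ≡ false
open Graph public

TriangleFree : ∀ {m} → Graph m → Set
TriangleFree G =
  ¬ (Σ _ λ i → Σ _ λ j → Σ _ λ k →
       adj G i j ≡ true × adj G j k ≡ true × adj G i k ≡ true)

Independent : ∀ {m} → Graph m → Subset m → Set
Independent G S = ∀ i j → i ∈ S → j ∈ S → adj G i j ≡ false

MaximalIndependent : ∀ {m} → Graph m → Subset m → Set
MaximalIndependent G S =
  Independent G S × (∀ T → S ⊆ T → Independent G T → T ≡ S)

-- There is a (3,t)'-system (H, 𝓕) with |V(H)| = m and |𝓕| = k.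
-- The family 𝓕 is a duplicate-free list of subsets.
HasSystem : (t m k : ℕ) → Set
HasSystem t m k =
  Σ (Graph m) λ H → Σ (List (Subset m)) λ 𝓕 →
    TriangleFree H × Unique 𝓕 ×
    All (λ S → ∣ S ∣ ≡ t × MaximalIndependent H S) 𝓕 ×
    length 𝓕 ≡ k

-- s'_{3,t}(m) = k : k is the maximum of |𝓕| over all (3,t)'-systems on m vertices.
IsS'₃ : (t m k : ℕ) → Set
IsS'₃ t m k = HasSystem t m k × (∀ k' → HasSystem t m k' → k' ≤ k)

{-# OPTIONS --safe #-}
-- Double counting the pairs (v , S) with S ∈ 𝓕 and v ∉ S gives
-- ∑_v |{S ∈ 𝓕 : v ∉ S}| = (m − t)|𝓕|, so some vertex v is avoided by at least
-- (1 − t/m)|𝓕| members of 𝓕. Replacing v by M − m + 1 pairwise non-adjacent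
-- twins (vertices with the neighbourhood of v) keeps the graph triangle-free,
-- and every maximal independent set avoiding v stays maximal independent with
-- the same size, which yields a (3,t)'-system on M vertices of that size.
module Submission where

open import Defs hiding (sym)
import Algebra.Properties.CommutativeMonoid.Sum as Sum
open import Data.Bool using (Bool; true; false)
open import Data.Bool.Properties using (¬-not)
open import Data.Fin using (Fin; splitAt; _↑ˡ_) renaming (zero to fzero; suc to fsuc)
open import Data.Fin.Properties using (splitAt-↑ˡ)
open import Data.Fin.Subset using (Subset; inside; outside; _∈_; _∉_; _⊆_; ∣_∣; ∁; _∪_; ⁅_⁆)
open import Data.Fin.Subset.Properties using (_∈?_; x∈∁p⇒x∉p; ∣∁p∣≡n∸∣p∣; ∣⊥∣≡0; ⊆-antisym; x∈p∪q⁻; x∈p∪q⁺; p⊆p∪q; x∈⁅x⁆; x∈⁅y⁆⇒x≡y)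
open import Data.List using (List; []; _∷_; length; filter; map)
open import Data.List.Properties using (length-map)
open import Data.List.Relation.Unary.All as All using (All; []; _∷_)
import Data.List.Relation.Unary.All.Properties as AllP
open import Data.List.Relation.Unary.Unique.Propositional using (Unique)
import Data.List.Relation.Unary.Unique.Propositional.Properties as Unique
open import Data.Nat using (ℕ; zero; suc; _+_; _*_; _∸_; _≤_; _≤?_)
open import Data.Nat.Properties
open import Data.Product using (∃; _×_; _,_; proj₁)
open import Data.Sum using (inj₁; inj₂; [_,_]′)
open import Data.Vec using ([]; _∷_; _++_; replicate; lookup; tabulate)
open import Data.Vec.Properties using (lookup⇒[]=; []=⇒lookup; lookup∘tabulate; tabulate∘lookup; tabulate-cong; lookup-splitAt; lookup-replicate)
open import Function using (id; const; _∘_)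
open import Function.Definitions using (StrictlySurjective)
open import Relation.Binary.PropositionalEquality
open import Relation.Nullary using (does; yes; no)
open import Relation.Unary using (Pred; Decidable)

open Sum +-0-commutativeMonoid using (sum-syntax; ∑-distrib-+; sum-cong-≗; sum-replicate-zero)

𝟙 : Bool → ℕ
𝟙 true  = 1
𝟙 false = 0

length-filter-∷ : ∀ {a p} {A : Set a} {P : Pred A p} (P? : Decidable P) x (xs : List A) →
                  length (filter P? (x ∷ xs)) ≡ 𝟙 (does (P? x)) + length (filter P? xs)
length-filter-∷ P? x xs with does (P? x)
... | true  = refl
... | false = refl

∑-𝟙-∈≡∣p∣ : ∀ {n} (p : Subset n) → ∑[ v < n ] 𝟙 (does (v ∈? p)) ≡ ∣ p ∣
∑-𝟙-∈≡∣p∣ []            = refl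
∑-𝟙-∈≡∣p∣ (inside  ∷ p) = cong suc (∑-𝟙-∈≡∣p∣ p)
∑-𝟙-∈≡∣p∣ (outside ∷ p) = ∑-𝟙-∈≡∣p∣ p

avoiding : ∀ {n} → Fin n → List (Subset n) → List (Subset n)
avoiding v = filter (λ S → v ∈? ∁ S)

∑-length-avoiding : ∀ {n t} (𝓕 : List (Subset n)) → All (λ S → ∣ S ∣ ≡ t) 𝓕 →
                    ∑[ v < n ] length (avoiding v 𝓕) ≡ (n ∸ t) * length 𝓕
∑-length-avoiding {n} {t} [] [] = trans (sum-replicate-zero n) (sym (*-zeroʳ (n ∸ t)))
∑-length-avoiding {n} {t} (S ∷ 𝓕) (∣S∣≡t ∷ ∣𝓕∣≡t) = begin
  ∑[ v < n ] length (avoiding v (S ∷ 𝓕))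
    ≡⟨ sum-cong-≗ (λ v → length-filter-∷ (λ S → v ∈? ∁ S) S 𝓕) ⟩
  ∑[ v < n ] (𝟙 (does (v ∈? ∁ S)) + length (avoiding v 𝓕))
    ≡⟨ ∑-distrib-+ (λ v → 𝟙 (does (v ∈? ∁ S))) (λ v → length (avoiding v 𝓕)) ⟩
  ∑[ v < n ] 𝟙 (does (v ∈? ∁ S)) + ∑[ v < n ] length (avoiding v 𝓕)
    ≡⟨ cong₂ _+_ (trans (∑-𝟙-∈≡∣p∣ (∁ S)) (∣∁p∣≡n∸∣p∣ S)) (∑-length-avoiding 𝓕 ∣𝓕∣≡t) ⟩
  (n ∸ ∣ S ∣) + (n ∸ t) * length 𝓕
    ≡⟨ cong (λ s → n ∸ s + (n ∸ t) * length 𝓕) ∣S∣≡t ⟩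
  (n ∸ t) + (n ∸ t) * length 𝓕
    ≡⟨ *-suc (n ∸ t) (length 𝓕) ⟨
  (n ∸ t) * suc (length 𝓕) ∎
  where open ≡-Reasoning

average≤some : ∀ {n} (f : Fin (suc n) → ℕ) → ∃ λ v → ∑[ i < suc n ] f i ≤ suc n * f v
average≤some {zero}  f = fzero , ≤-refl
average≤some {suc n} f with average≤some (f ∘ fsuc)
... | v , ∑≤ with f fzero ≤? f (fsuc v)
...   | yes f0≤fv = fsuc v , +-mono-≤ f0≤fv ∑≤
...   | no  f0≰fv = fzero , +-monoʳ-≤ (f fzero) (≤-trans ∑≤ (*-monoʳ-≤ (suc n) (<⇒≤ (≰⇒> f0≰fv))))

pullback : ∀ {m n} → Graph m → (Fin n → Fin m) → Graph n
pullback H f = record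
  { adj    = λ i j → adj H (f i) (f j)
  ; sym    = λ i j → Graph.sym H (f i) (f j)
  ; irrefl = λ i → irrefl H (f i)
  }

preimage : ∀ {m n} → (Fin n → Fin m) → Subset m → Subset n
preimage f S = tabulate (λ i → lookup S (f i))

module _ {m n} (f : Fin n → Fin m) {S : Subset m} where

  ∈-preimage⁺ : ∀ {i} → f i ∈ S → i ∈ preimage f S
  ∈-preimage⁺ {i} fi∈S = lookup⇒[]= i (preimage f S) (trans (lookup∘tabulate _ i) ([]=⇒lookup fi∈S))

  ∈-preimage⁻ : ∀ {i} → i ∈ preimage f S → f i ∈ S
  ∈-preimage⁻ {i} i∈f⁻¹S = lookup⇒[]= (f i) S (trans (sym (lookup∘tabulate _ i)) ([]=⇒lookup i∈f⁻¹S))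

pullback-triangleFree : ∀ {m n} {H : Graph m} (f : Fin n → Fin m) → TriangleFree H → TriangleFree (pullback H f)
pullback-triangleFree f triangleFree (i , j , k , ij , jk , ik) = triangleFree (f i , f j , f k , ij , jk , ik)

preimage-independent : ∀ {m n} {H : Graph m} (f : Fin n → Fin m) {S} →
                       Independent H S → Independent (pullback H f) (preimage f S)
preimage-independent f S-indep i j i∈ j∈ = S-indep (f i) (f j) (∈-preimage⁻ f i∈) (∈-preimage⁻ f j∈)

independent-∪⁅⁆ : ∀ {m} {H : Graph m} {S b} → Independent H S → (∀ a → a ∈ S → adj H a b ≡ false) →
                  Independent H (S ∪ ⁅ b ⁆)
independent-∪⁅⁆ {H = H} {S} {b} S-indep b-free a c a∈ c∈ with x∈p∪q⁻ S ⁅ b ⁆ a∈ | x∈p∪q⁻ S ⁅ b ⁆ c∈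
... | inj₁ a∈S | inj₁ c∈S = S-indep a c a∈S c∈S
... | inj₁ a∈S | inj₂ c≡b rewrite x∈⁅y⁆⇒x≡y b c≡b = b-free a a∈S
... | inj₂ a≡b | inj₁ c∈S rewrite x∈⁅y⁆⇒x≡y b a≡b = trans (Graph.sym H b c) (b-free c c∈S)
... | inj₂ a≡b | inj₂ c≡b rewrite x∈⁅y⁆⇒x≡y b a≡b | x∈⁅y⁆⇒x≡y b c≡b = irrefl H b

nonadjacent⇒∈-maximal : ∀ {m} {H : Graph m} {S b} → MaximalIndependent H S →
                        (∀ a → a ∈ S → adj H a b ≡ false) → b ∈ S
nonadjacent⇒∈-maximal {H = H} {S} {b} (S-indep , S-max) b-free =
  subst (b ∈_) (S-max (S ∪ ⁅ b ⁆) (p⊆p∪q ⁅ b ⁆) (independent-∪⁅⁆ {H = H} S-indep b-free)) (x∈p∪q⁺ (inj₂ (x∈⁅x⁆ b)))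

module _ {m n} {f : Fin n → Fin m} (f-surjective : StrictlySurjective _≡_ f) where

  preimage-maximalIndependent : ∀ {H : Graph m} {S} → MaximalIndependent H S → MaximalIndependent (pullback H f) (preimage f S)
  preimage-maximalIndependent {H} {S} S-mi@(S-indep , _) =
    preimage-independent {H = H} f S-indep , λ T f⁻¹S⊆T T-indep → ⊆-antisym (T⊆f⁻¹S T f⁻¹S⊆T T-indep) f⁻¹S⊆T
    where
    T⊆f⁻¹S : ∀ T → preimage f S ⊆ T → Independent (pullback H f) T → T ⊆ preimage f S
    T⊆f⁻¹S T f⁻¹S⊆T T-indep {x} x∈T = ∈-preimage⁺ f (nonadjacent⇒∈-maximal {H = H} S-mi fx-free)
      where
      fx-free : ∀ a → a ∈ S → adj H a (f x) ≡ false
      fx-free a a∈S with i , refl ← f-surjective a = T-indep i x (f⁻¹S⊆T (∈-preimage⁺ f a∈S)) x∈T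

  preimage-injective : ∀ {S T} → preimage f S ≡ preimage f T → S ≡ T
  preimage-injective {S} {T} f⁻¹S≡f⁻¹T = begin
    S                    ≡⟨ tabulate∘lookup S ⟨
    tabulate (lookup S)  ≡⟨ tabulate-cong lookup-S≗lookup-T ⟩
    tabulate (lookup T)  ≡⟨ tabulate∘lookup T ⟩
    T                    ∎
    where
    open ≡-Reasoning
    lookup-S≗lookup-T : ∀ j → lookup S j ≡ lookup T j
    lookup-S≗lookup-T j with i , refl ← f-surjective j = begin
      lookup S (f i)               ≡⟨ lookup∘tabulate _ i ⟨
      lookup (preimage f S) i      ≡⟨ cong (λ U → lookup U i) f⁻¹S≡f⁻¹T ⟩
      lookup (preimage f T) i      ≡⟨ lookup∘tabulate _ i ⟩
      lookup T (f i)               ∎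

∣p++q∣≡∣p∣+∣q∣ : ∀ {m n} (p : Subset m) (q : Subset n) → ∣ p ++ q ∣ ≡ ∣ p ∣ + ∣ q ∣
∣p++q∣≡∣p∣+∣q∣ []            q = refl
∣p++q∣≡∣p∣+∣q∣ (inside  ∷ p) q = cong suc (∣p++q∣≡∣p∣+∣q∣ p q)
∣p++q∣≡∣p∣+∣q∣ (outside ∷ p) q = ∣p++q∣≡∣p∣+∣q∣ p q

x∉p⇒p[x]≡outside : ∀ {n} {x : Fin n} {p : Subset n} → x ∉ p → lookup p x ≡ outside
x∉p⇒p[x]≡outside {x = x} {p} x∉p = ¬-not (x∉p ∘ lookup⇒[]= x p)

-- pullback H (collapse k v) is H with k new, pairwise non-adjacent twins of v.
collapse : ∀ {m} k → Fin m → Fin (m + k) → Fin m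
collapse {m} k v i = [ id , const v ]′ (splitAt m i)

module _ {m} (k : ℕ) (v : Fin m) where

  collapse-surjective : StrictlySurjective _≡_ (collapse k v)
  collapse-surjective j = j ↑ˡ k , cong [ id , const v ]′ (splitAt-↑ˡ m j k)

  preimage-collapse : ∀ S → preimage (collapse k v) S ≡ S ++ replicate k (lookup S v)
  preimage-collapse S = begin
    tabulate (lookup S ∘ collapse k v)                            ≡⟨ tabulate-cong lookup-collapse ⟩
    tabulate (lookup (S ++ replicate k (lookup S v)))             ≡⟨ tabulate∘lookup _ ⟩
    S ++ replicate k (lookup S v)                                 ∎
    where
    open ≡-Reasoning
    lookup-collapse : ∀ i → lookup S (collapse k v i) ≡ lookup (S ++ replicate k (lookup S v)) i
    lookup-collapse i = trans (by-part (splitAt m i)) (sym (lookup-splitAt m S _ i))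
      where
      by-part : ∀ x → lookup S ([ id , const v ]′ x) ≡ [ lookup S , lookup (replicate k (lookup S v)) ]′ x
      by-part (inj₁ j) = refl
      by-part (inj₂ j) = sym (lookup-replicate j (lookup S v))

  ∣preimage-collapse∣ : ∀ {S} → v ∉ S → ∣ preimage (collapse k v) S ∣ ≡ ∣ S ∣
  ∣preimage-collapse∣ {S} v∉S = begin
    ∣ preimage (collapse k v) S ∣          ≡⟨ cong ∣_∣ (preimage-collapse S) ⟩
    ∣ S ++ replicate k (lookup S v) ∣      ≡⟨ ∣p++q∣≡∣p∣+∣q∣ S _ ⟩
    ∣ S ∣ + ∣ replicate k (lookup S v) ∣   ≡⟨ cong (λ b → ∣ S ∣ + ∣ replicate k b ∣) (x∉p⇒p[x]≡outside v∉S) ⟩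
    ∣ S ∣ + ∣ replicate k outside ∣        ≡⟨ cong (∣ S ∣ +_) (∣⊥∣≡0 k) ⟩
    ∣ S ∣ + 0                              ≡⟨ +-identityʳ ∣ S ∣ ⟩
    ∣ S ∣                                  ∎
    where open ≡-Reasoning

avoiding-system : ∀ {t m} k (H : Graph m) (𝓕 : List (Subset m)) v →
                  TriangleFree H → Unique 𝓕 → All (λ S → ∣ S ∣ ≡ t × MaximalIndependent H S) 𝓕 →
                  HasSystem t (m + k) (length (avoiding v 𝓕))
avoiding-system {t} {m} k H 𝓕 v triangleFree unique members =
  pullback H f , map (preimage f) (avoiding v 𝓕) ,
  pullback-triangleFree {H = H} f triangleFree ,
  Unique.map⁺ (preimage-injective (collapse-surjective k v)) (Unique.filter⁺ v∈∁? unique) ,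
  AllP.map⁺ (All.map preimage-member (All.zip (AllP.filter⁺ v∈∁? members , AllP.all-filter v∈∁? 𝓕))) ,
  length-map (preimage f) (avoiding v 𝓕)
  where
  f : Fin (m + k) → Fin m
  f = collapse k v
  v∈∁? : Decidable (λ S → v ∈ ∁ S)
  v∈∁? S = v ∈? ∁ S
  preimage-member : ∀ {S} → (∣ S ∣ ≡ t × MaximalIndependent H S) × v ∈ ∁ S →
                    ∣ preimage f S ∣ ≡ t × MaximalIndependent (pullback H f) (preimage f S)
  preimage-member ((∣S∣≡t , S-mi) , v∈∁S) =
    trans (∣preimage-collapse∣ k v (x∈∁p⇒x∉p v∈∁S)) ∣S∣≡t ,
    preimage-maximalIndependent (collapse-surjective k v) {H} S-mi

lemma31 : (M m t : ℕ) → 1 ≤ t → t ≤ m → m ≤ M →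
    (s-m s-M : ℕ) → IsS'₃ t m s-m → IsS'₃ t M s-M →
    (m ∸ t) * s-m ≤ m * s-M
lemma31 M zero       t _ _ _   s-m s-M _ _ = ≤-reflexive (cong (_* s-m) (0∸n≡0 t))
lemma31 M m@(suc _) t _ _ m≤M s-m s-M ((H , 𝓕 , triangleFree , unique , members , refl) , _) (_ , s-M-maximum)
  with v , ∑≤m*avoiding-v ← average≤some (λ u → length (avoiding u 𝓕)) = begin
    (m ∸ t) * length 𝓕                ≡⟨ ∑-length-avoiding 𝓕 (All.map proj₁ members) ⟨
    ∑[ u < m ] length (avoiding u 𝓕)  ≤⟨ ∑≤m*avoiding-v ⟩
    m * length (avoiding v 𝓕)         ≤⟨ *-monoʳ-≤ m (s-M-maximum _ system) ⟩
    m * s-M                           ∎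
  where
  open ≤-Reasoning
  system : HasSystem t M (length (avoiding v 𝓕))
  system with k , refl ← m≤n⇒∃[o]m+o≡n m≤M = avoiding-system k H 𝓕 v triangleFree unique members
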